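{- For integers $n\geq 0$ define \[ Y_n(x)=\tfrac{1}{2}\left(U_{n+1}(x+\tfrac{1}{2})-U_n(x+\tfrac{1}{2})\right),\qquad Z_n(x)=\tfrac{1}{2}\left(U_{n+1}(x+\tfrac{1}{2})+U_n(x+\tfrac{1}{2})\right), \] where $U_n$ is the $n$th Chebyshev polynomial of the second kind. Then for every $n\geq 0$ the pair $Y=Y_n$, $Z=Z_n$ is a solution in $\mathbb{Q}[x]$ of \[ (2x+3)Y(x)^2 + (1-2x)Z(x)^2 = 1, \] so that this equation has infinitely many solutions. Furthermore, for $n\geq 1$, \[ Y_{n+1}(x) = (2x+1)Y_n(x) - Y_{n-1}(x),\qquad Z_{n+1}(x) = (2x+1)Z_n(x) - Z_{n-1}(x), \] with $Y_0(x)=x$, $Y_1(x)=2x^2+x-\tfrac{1}{2}$, $Z_0(x)=x+1$, $Z_1(x)=2x^2+3x+\tfrac{1}{2}$.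
   Context: The Chebyshev polynomials of the second kind are defined by $U_0(y)=1$, $U_1(y)=2y$, $U_{n+1}(y)=2yU_n(y)-U_{n-1}(y)$. -}

module Defs where

open import Data.Nat using (ℕ; zero; suc)
open import Data.Integer using (+_)
open import Data.Rational using (ℚ; 0ℚ; 1ℚ; ½; -½; _/_) renaming (_+_ to _+ℚ_; _*_ to _*ℚ_; -_ to -ℚ_)
open import Data.List using (List; []; _∷_)
open import Relation.Binary.PropositionalEquality using (_≡_)

-- Polynomials in ℚ[x], represented by coefficient lists:
-- the list a₀ ∷ a₁ ∷ … ∷ aₖ ∷ [] stands for a₀ + a₁ x + … + aₖ xᵏ.
Poly : Set
Poly = List ℚ

coeff : Poly → ℕ → ℚ
coeff []       _       = 0ℚ
coeff (a ∷ p)  zero    = a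
coeff (a ∷ p)  (suc i) = coeff p i

-- equality in ℚ[x]: all coefficients agree (trailing zeros irrelevant)
infix 4 _≈P_
_≈P_ : Poly → Poly → Set
p ≈P q = ∀ i → coeff p i ≡ coeff q i

infixl 6 _+P_ _-P_
infixl 7 _*P_

_+P_ : Poly → Poly → Poly
[]      +P q       = q
(a ∷ p) +P []      = a ∷ p
(a ∷ p) +P (b ∷ q) = (a +ℚ b) ∷ (p +P q)

_·P_ : ℚ → Poly → Poly
c ·P []      = []
c ·P (a ∷ p) = (c *ℚ a) ∷ (c ·P p)

_-P_ : Poly → Poly → Poly
p -P q = p +P ((-ℚ 1ℚ) ·P q)

_*P_ : Poly → Poly → Poly
[]      *P q = []
(a ∷ p) *P q = (a ·P q) +P (0ℚ ∷ (p *P q))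

C : ℚ → Poly
C c = c ∷ []

X : Poly
X = 0ℚ ∷ 1ℚ ∷ []

2ℚ 3ℚ : ℚ
2ℚ = + 2 / 1
3ℚ = + 3 / 1

U : ℕ → Poly → Poly
U zero          y = C 1ℚ
U (suc zero)    y = C 2ℚ *P y
U (suc (suc n)) y = (C 2ℚ *P y) *P U (suc n) y -P U n y

xh : Poly
xh = X +P C ½

Y : ℕ → Poly
Y n = ½ ·P (U (suc n) xh -P U n xh)

Z : ℕ → Poly
Z n = ½ ·P (U (suc n) xh +P U n xh)

module Submission where

-- Put  w = 2(x + ½) = 2x + 1  and  uₙ = Uₙ(x + ½), so that
-- u₀ = 1, u₁ = w, uₙ₊₂ = w uₙ₊₁ − uₙ, Yₙ = ½(uₙ₊₁ − uₙ), Zₙ = ½(uₙ₊₁ + uₙ).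
--   * The Chebyshev invariant  uₙ₊₁² + uₙ² − w uₙ₊₁ uₙ = 1  (induction on n)
--     and the identity  (2x+3)(½(a−b))² + (1−2x)(½(a+b))² = a² + b² − (2x+1)ab
--     give  (2x+3)Yₙ² + (1−2x)Zₙ² = 1.
--   * Any fixed linear combination of consecutive terms of a solution of
--     sₙ₊₂ = w sₙ₊₁ − sₙ solves the same recurrence: this gives the
--     recurrences for Yₙ and Zₙ.
--   * At x = ½ the recurrence for Zₙ reads zₙ₊₂ = 2zₙ₊₁ − zₙ, so zₙ = Zₙ(½)
--     increases by 1 at each step and the pairs (Yₙ, Zₙ) are pairwise distinct.

open import Defs
open import Level using (0ℓ)
open import Data.Nat using (ℕ; zero; suc; _<_; s≤s)
import Data.Nat.Properties as ℕP
open import Data.Rational using (ℚ; 0ℚ; 1ℚ; ½; -½)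
  renaming (_+_ to _+q_; _*_ to _*q_; -_ to -q_; _<_ to _<q_)
import Data.Rational as ℚ
import Data.Rational.Properties as ℚP
open import Data.Rational.Solver using (module +-*-Solver)
open import Data.List using ([]; _∷_)
open import Data.Maybe using (Maybe; just; nothing)
open import Data.Product using (_×_; _,_)
open import Data.Sum using (inj₁; inj₂)
open import Relation.Nullary using (¬_; yes; no)
open import Relation.Binary using (Setoid; tri<; tri≈; tri>)
import Relation.Binary.Reasoning.Setoid as SetoidReasoning
open import Relation.Binary.PropositionalEquality
open import Algebra.Bundles using (CommutativeRing)
import Algebra.Solver.Ring.AlmostCommutativeRing as ACR
import Algebra.Solver.Ring as RingSolver

-- Coefficientwise equality as a record, so that both polynomials can be
-- recovered from the type (unlike the function type  p ≈P q).

infix 4 _≋_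
record _≋_ (p q : Poly) : Set where
  constructor mk
  field get : p ≈P q
open _≋_ public

≋-refl : ∀ {p} → p ≋ p
≋-refl = mk λ i → refl

≋-sym : ∀ {p q} → p ≋ q → q ≋ p
≋-sym (mk e) = mk λ i → sym (e i)

≋-trans : ∀ {p q r} → p ≋ q → q ≋ r → p ≋ r
≋-trans (mk e) (mk f) = mk λ i → trans (e i) (f i)

≋-setoid : Setoid 0ℓ 0ℓ
≋-setoid = record
  { Carrier = Poly ; _≈_ = _≋_
  ; isEquivalence = record { refl = ≋-refl ; sym = ≋-sym ; trans = ≋-trans } }

module ≋-Reasoning = SetoidReasoning ≋-setoid

≡⇒≋ : ∀ {p q} → p ≡ q → p ≋ q
≡⇒≋ refl = ≋-refl

∷-cong : ∀ {a b p q} → a ≡ b → p ≋ q → (a ∷ p) ≋ (b ∷ q)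
∷-cong e (mk f) = mk λ { zero → e ; (suc i) → f i }

C0≋0 : C 0ℚ ≋ []
C0≋0 = mk λ { zero → refl ; (suc i) → refl }

tail-≋ : ∀ {a b p q} → (a ∷ p) ≋ (b ∷ q) → p ≋ q
tail-≋ (mk e) = mk λ i → e (suc i)

coeff-+ : ∀ p q i → coeff (p +P q) i ≡ coeff p i +q coeff q i
coeff-+ []      q       i       = sym (ℚP.+-identityˡ _)
coeff-+ (a ∷ p) []      i       = sym (ℚP.+-identityʳ _)
coeff-+ (a ∷ p) (b ∷ q) zero    = refl
coeff-+ (a ∷ p) (b ∷ q) (suc i) = coeff-+ p q i

coeff-· : ∀ c p i → coeff (c ·P p) i ≡ c *q coeff p i
coeff-· c []      i       = sym (ℚP.*-zeroʳ c)
coeff-· c (a ∷ p) zero    = refl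
coeff-· c (a ∷ p) (suc i) = coeff-· c p i

+P-cong : ∀ {p p′ q q′} → p ≋ p′ → q ≋ q′ → p +P q ≋ p′ +P q′
+P-cong {p} {p′} {q} {q′} (mk e) (mk f) = mk λ i → begin
  coeff (p +P q) i         ≡⟨ coeff-+ p q i ⟩
  coeff p i +q coeff q i   ≡⟨ cong₂ _+q_ (e i) (f i) ⟩
  coeff p′ i +q coeff q′ i ≡⟨ coeff-+ p′ q′ i ⟨
  coeff (p′ +P q′) i       ∎
  where open ≡-Reasoning

·P-cong : ∀ {c p q} → p ≋ q → c ·P p ≋ c ·P q
·P-cong {c} {p} {q} (mk e) = mk λ i → begin
  coeff (c ·P p) i  ≡⟨ coeff-· c p i ⟩
  c *q coeff p i    ≡⟨ cong (c *q_) (e i) ⟩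
  c *q coeff q i    ≡⟨ coeff-· c q i ⟨
  coeff (c ·P q) i  ∎
  where open ≡-Reasoning

+P-assoc : ∀ p q r → (p +P q) +P r ≋ p +P (q +P r)
+P-assoc p q r = mk λ i → begin
  coeff ((p +P q) +P r) i                  ≡⟨ coeff-+ (p +P q) r i ⟩
  coeff (p +P q) i +q coeff r i            ≡⟨ cong (_+q coeff r i) (coeff-+ p q i) ⟩
  (coeff p i +q coeff q i) +q coeff r i    ≡⟨ ℚP.+-assoc (coeff p i) (coeff q i) (coeff r i) ⟩
  coeff p i +q (coeff q i +q coeff r i)    ≡⟨ cong (coeff p i +q_) (coeff-+ q r i) ⟨
  coeff p i +q coeff (q +P r) i            ≡⟨ coeff-+ p (q +P r) i ⟨
  coeff (p +P (q +P r)) i                  ∎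
  where open ≡-Reasoning

+P-comm : ∀ p q → p +P q ≋ q +P p
+P-comm p q = mk λ i → begin
  coeff (p +P q) i        ≡⟨ coeff-+ p q i ⟩
  coeff p i +q coeff q i  ≡⟨ ℚP.+-comm (coeff p i) (coeff q i) ⟩
  coeff q i +q coeff p i  ≡⟨ coeff-+ q p i ⟨
  coeff (q +P p) i        ∎
  where open ≡-Reasoning

+P-identityʳ : ∀ p → p +P [] ≋ p
+P-identityʳ p = mk λ i → trans (coeff-+ p [] i) (ℚP.+-identityʳ _)

-- Negation is scaling by −1, exactly as in the definition of _-P_.
negP : Poly → Poly
negP p = (-q 1ℚ) ·P p

+P-inverseˡ : ∀ p → negP p +P p ≋ []
+P-inverseˡ p = mk λ i → begin
  coeff (negP p +P p) i                 ≡⟨ coeff-+ (negP p) p i ⟩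
  coeff (negP p) i +q coeff p i         ≡⟨ cong (_+q coeff p i) (coeff-· (-q 1ℚ) p i) ⟩
  (-q 1ℚ) *q coeff p i +q coeff p i     ≡⟨ minus-one-cancels (coeff p i) ⟩
  0ℚ                                    ∎
  where
  open ≡-Reasoning
  open +-*-Solver
  minus-one-cancels : ∀ x → (-q 1ℚ) *q x +q x ≡ 0ℚ
  minus-one-cancels = solve 1 (λ x → (con (-q 1ℚ) :* x) :+ x := con 0ℚ) refl

+P-inverseʳ : ∀ p → p +P negP p ≋ []
+P-inverseʳ p = ≋-trans (+P-comm p (negP p)) (+P-inverseˡ p)

·P-distrib : ∀ c p q → c ·P (p +P q) ≋ c ·P p +P c ·P q
·P-distrib c p q = mk λ i → begin
  coeff (c ·P (p +P q)) i                ≡⟨ coeff-· c (p +P q) i ⟩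
  c *q coeff (p +P q) i                  ≡⟨ cong (c *q_) (coeff-+ p q i) ⟩
  c *q (coeff p i +q coeff q i)          ≡⟨ ℚP.*-distribˡ-+ c _ _ ⟩
  c *q coeff p i +q c *q coeff q i       ≡⟨ cong₂ _+q_ (coeff-· c p i) (coeff-· c q i) ⟨
  coeff (c ·P p) i +q coeff (c ·P q) i   ≡⟨ coeff-+ (c ·P p) (c ·P q) i ⟨
  coeff (c ·P p +P c ·P q) i             ∎
  where open ≡-Reasoning

·P-assoc : ∀ c d p → (c *q d) ·P p ≋ c ·P (d ·P p)
·P-assoc c d p = mk λ i → begin
  coeff ((c *q d) ·P p) i    ≡⟨ coeff-· (c *q d) p i ⟩
  (c *q d) *q coeff p i      ≡⟨ ℚP.*-assoc c d _ ⟩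
  c *q (d *q coeff p i)      ≡⟨ cong (c *q_) (coeff-· d p i) ⟨
  c *q coeff (d ·P p) i      ≡⟨ coeff-· c (d ·P p) i ⟨
  coeff (c ·P (d ·P p)) i    ∎
  where open ≡-Reasoning

0·P : ∀ p → 0ℚ ·P p ≋ []
0·P p = mk λ i → trans (coeff-· 0ℚ p i) (ℚP.*-zeroˡ (coeff p i))

1·P : ∀ p → 1ℚ ·P p ≋ p
1·P p = mk λ i → trans (coeff-· 1ℚ p i) (ℚP.*-identityˡ (coeff p i))

shift-+ : ∀ p q → 0ℚ ∷ (p +P q) ≋ (0ℚ ∷ p) +P (0ℚ ∷ q)
shift-+ p q = ∷-cong (sym (ℚP.+-identityˡ 0ℚ)) ≋-refl

+P-interchange : ∀ a b c d → (a +P b) +P (c +P d) ≋ (a +P c) +P (b +P d)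
+P-interchange a b c d = mk λ i → begin
  coeff ((a +P b) +P (c +P d)) i
    ≡⟨ trans (coeff-+ (a +P b) (c +P d) i) (cong₂ _+q_ (coeff-+ a b i) (coeff-+ c d i)) ⟩
  (coeff a i +q coeff b i) +q (coeff c i +q coeff d i)
    ≡⟨ middle-four (coeff a i) (coeff b i) (coeff c i) (coeff d i) ⟩
  (coeff a i +q coeff c i) +q (coeff b i +q coeff d i)
    ≡⟨ trans (coeff-+ (a +P c) (b +P d) i) (cong₂ _+q_ (coeff-+ a c i) (coeff-+ b d i)) ⟨
  coeff ((a +P c) +P (b +P d)) i ∎
  where
  open ≡-Reasoning
  open +-*-Solver
  middle-four : ∀ a b c d → (a +q b) +q (c +q d) ≡ (a +q c) +q (b +q d)
  middle-four = solve 4 (λ a b c d → (a :+ b) :+ (c :+ d) := (a :+ c) :+ (b :+ d)) refl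

*P-zero-equivˡ : ∀ p q → p ≋ [] → p *P q ≋ []
*P-zero-equivˡ []      q e = ≋-refl
*P-zero-equivˡ (a ∷ p) q e = ≋-trans
  (+P-cong (≋-trans (≡⇒≋ (cong (_·P q) (get e 0))) (0·P q))
           (∷-cong refl (*P-zero-equivˡ p q (mk λ i → get e (suc i)))))
  C0≋0

*P-congˡ : ∀ {p p′} q → p ≋ p′ → p *P q ≋ p′ *P q
*P-congˡ {[]}    {[]}     q e = ≋-refl
*P-congˡ {[]}    {b ∷ p′} q e = ≋-sym (*P-zero-equivˡ (b ∷ p′) q (≋-sym e))
*P-congˡ {a ∷ p} {[]}     q e = *P-zero-equivˡ (a ∷ p) q e
*P-congˡ {a ∷ p} {b ∷ p′} q e =
  +P-cong (≡⇒≋ (cong (_·P q) (get e 0))) (∷-cong refl (*P-congˡ q (tail-≋ e)))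

*P-congʳ : ∀ p {q q′} → q ≋ q′ → p *P q ≋ p *P q′
*P-congʳ []      e = ≋-refl
*P-congʳ (a ∷ p) e = +P-cong (·P-cong e) (∷-cong refl (*P-congʳ p e))

*P-cong : ∀ {p p′ q q′} → p ≋ p′ → q ≋ q′ → p *P q ≋ p′ *P q′
*P-cong {p′ = p′} {q = q} e f = ≋-trans (*P-congˡ q e) (*P-congʳ p′ f)

*P-zeroʳ : ∀ q → q *P [] ≋ []
*P-zeroʳ []      = ≋-refl
*P-zeroʳ (b ∷ q) = mk λ { zero → refl ; (suc i) → get (*P-zeroʳ q) i }

*P-constʳ : ∀ q a → q *P C a ≋ a ·P q
*P-constʳ []      a = ≋-refl
*P-constʳ (b ∷ q) a = ∷-cong (trans (ℚP.+-identityʳ _) (ℚP.*-comm b a)) (*P-constʳ q a)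

*P-shiftʳ : ∀ p q → p *P (0ℚ ∷ q) ≋ 0ℚ ∷ (p *P q)
*P-shiftʳ []      q = mk λ { zero → refl ; (suc i) → refl }
*P-shiftʳ (a ∷ p) q = ∷-cong (trans (ℚP.+-identityʳ _) (ℚP.*-zeroʳ a)) (+P-cong ≋-refl (*P-shiftʳ p q))

*P-distribˡ : ∀ p q r → p *P (q +P r) ≋ p *P q +P p *P r
*P-distribˡ []      q r = ≋-refl
*P-distribˡ (a ∷ p) q r = ≋-trans
  (+P-cong (·P-distrib a q r) (≋-trans (∷-cong refl (*P-distribˡ p q r)) (shift-+ (p *P q) (p *P r))))
  (+P-interchange (a ·P q) (a ·P r) (0ℚ ∷ (p *P q)) (0ℚ ∷ (p *P r)))

-- Commutativity: split  a ∷ p = C a +P x·p  and use the right-hand laws.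
*P-comm : ∀ p q → p *P q ≋ q *P p
*P-comm []      q = ≋-sym (*P-zeroʳ q)
*P-comm (a ∷ p) q = ≋-sym (begin
  q *P (a ∷ p)                   ≈⟨ *P-congʳ q (∷-cong (sym (ℚP.+-identityʳ a)) ≋-refl) ⟩
  q *P (C a +P (0ℚ ∷ p))         ≈⟨ *P-distribˡ q (C a) (0ℚ ∷ p) ⟩
  q *P C a +P q *P (0ℚ ∷ p)      ≈⟨ +P-cong (*P-constʳ q a) (*P-shiftʳ q p) ⟩
  a ·P q +P (0ℚ ∷ (q *P p))      ≈⟨ +P-cong ≋-refl (∷-cong refl (*P-comm q p)) ⟩
  a ·P q +P (0ℚ ∷ (p *P q))      ∎)
  where open ≋-Reasoning

*P-distribʳ : ∀ p q r → (q +P r) *P p ≋ q *P p +P r *P p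
*P-distribʳ p q r = ≋-trans (*P-comm (q +P r) p)
  (≋-trans (*P-distribˡ p q r) (+P-cong (*P-comm p q) (*P-comm p r)))

·P-*P-assoc : ∀ c p q → (c ·P p) *P q ≋ c ·P (p *P q)
·P-*P-assoc c []      q = ≋-refl
·P-*P-assoc c (a ∷ p) q = ≋-trans
  (+P-cong (·P-assoc c a q) (∷-cong (sym (ℚP.*-zeroʳ c)) (·P-*P-assoc c p q)))
  (≋-sym (·P-distrib c (a ·P q) (0ℚ ∷ (p *P q))))

*P-assoc : ∀ p q r → (p *P q) *P r ≋ p *P (q *P r)
*P-assoc []      q r = ≋-refl
*P-assoc (a ∷ p) q r = ≋-trans (*P-distribʳ r (a ·P q) (0ℚ ∷ (p *P q)))
  (+P-cong (·P-*P-assoc a q r) (≋-trans (+P-cong (0·P r) ≋-refl) (∷-cong refl (*P-assoc p q r))))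

*P-identityʳ : ∀ p → p *P C 1ℚ ≋ p
*P-identityʳ p = ≋-trans (*P-constʳ p 1ℚ) (1·P p)

*P-identityˡ : ∀ p → C 1ℚ *P p ≋ p
*P-identityˡ p = ≋-trans (*P-comm (C 1ℚ) p) (*P-identityʳ p)

ℚ[x] : CommutativeRing 0ℓ 0ℓ
ℚ[x] = record
  { Carrier = Poly ; _≈_ = _≋_ ; _+_ = _+P_ ; _*_ = _*P_ ; -_ = negP ; 0# = [] ; 1# = C 1ℚ
  ; isCommutativeRing = record
    { isRing = record
      { +-isAbelianGroup = record
        { isGroup = record
          { isMonoid = record
            { isSemigroup = record
              { isMagma = record
                { isEquivalence = Setoid.isEquivalence ≋-setoid
                ; ∙-cong = +P-cong }
              ; assoc = +P-assoc }
            ; identity = (λ p → ≋-refl) , +P-identityʳ }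
          ; inverse = +P-inverseˡ , +P-inverseʳ
          ; ⁻¹-cong = ·P-cong }
        ; comm = +P-comm }
      ; *-cong = *P-cong
      ; *-assoc = *P-assoc
      ; *-identity = *P-identityˡ , *P-identityʳ
      ; distrib = *P-distribˡ , *P-distribʳ }
    ; *-comm = *P-comm } }

-- The constants C : ℚ → ℚ[x] form a ring morphism, so the ring solver can
-- use rational coefficients in ℚ[x]; equality of constants is decidable.
C-morphism : ℚ.+-*-rawRing ACR.-Raw-AlmostCommutative⟶ ACR.fromCommutativeRing ℚ[x]
C-morphism = record
  { ⟦_⟧    = C
  ; +-homo = λ a b → ≋-refl
  ; *-homo = λ a b → ∷-cong (sym (ℚP.+-identityʳ (a *q b))) ≋-refl
  ; -‿homo = λ a → ∷-cong (neg-is-scaling a) ≋-refl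
  ; 0-homo = C0≋0
  ; 1-homo = ≋-refl }
  where
  open +-*-Solver
  neg-is-scaling : ∀ x → -q x ≡ (-q 1ℚ) *q x
  neg-is-scaling = solve 1 (λ x → (:- x) := (con (-q 1ℚ) :* x)) refl

C-≟ : ∀ a b → Maybe (C a ≋ C b)
C-≟ a b with a ℚP.≟ b
... | yes a≡b = just (≡⇒≋ (cong C a≡b))
... | no _    = nothing

module ℚ[x]-Solver = RingSolver ℚ.+-*-rawRing (ACR.fromCommutativeRing ℚ[x]) C-morphism C-≟

C-*P : ∀ c p → C c *P p ≋ c ·P p
C-*P c p = ≋-trans (+P-cong ≋-refl C0≋0) (+P-identityʳ (c ·P p))

module Chebyshev (y : Poly) where
  open ℚ[x]-Solver

  w : Poly
  w = C 2ℚ *P y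

  u : ℕ → Poly
  u n = U n y

  -- The quadratic form  a² + b² − w a b  is preserved by  (a, b) ↦ (w a − b, a)
  -- and equals 1 at (u₁, u₀): the Chebyshev invariant.
  invariant : ∀ n → u (suc n) *P u (suc n) +P u n *P u n -P w *P u (suc n) *P u n ≋ C 1ℚ
  invariant zero    = initial w
    where
    initial : ∀ w → w *P w +P C 1ℚ *P C 1ℚ -P w *P w *P C 1ℚ ≋ C 1ℚ
    initial = solve 1 (λ w → w :* w :+ con 1ℚ :* con 1ℚ :- w :* w :* con 1ℚ := con 1ℚ) ≋-refl
  invariant (suc n) = ≋-trans (step w (u (suc n)) (u n)) (invariant n)
    where
    step : ∀ w a b → (w *P a -P b) *P (w *P a -P b) +P a *P a -P w *P (w *P a -P b) *P a
                   ≋ a *P a +P b *P b -P w *P a *P b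
    step = solve 3 (λ w a b → (w :* a :- b) :* (w :* a :- b) :+ a :* a :- w :* (w :* a :- b) :* a
                             := a :* a :+ b :* b :- w :* a :* b) ≋-refl

  combination : ℚ → ℚ → ℕ → Poly
  combination α β n = C α *P u (suc n) +P C β *P u n

  combination-recurrence : ∀ α β n →
    combination α β (suc (suc n)) ≋ w *P combination α β (suc n) -P combination α β n
  combination-recurrence α β n = linear (C α) (C β) w (u (suc n)) (u n)
    where
    linear : ∀ α β w a b → α *P (w *P (w *P a -P b) -P a) +P β *P (w *P a -P b)
                         ≋ w *P (α *P (w *P a -P b) +P β *P a) -P (α *P a +P β *P b)
    linear = solve 5 (λ α β w a b → α :* (w :* (w :* a :- b) :- a) :+ β :* (w :* a :- b)
                                   := w :* (α :* (w :* a :- b) :+ β :* a) :- (α :* a :+ β :* b)) ≋-refl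

pell-form : Poly → Poly → Poly
pell-form y z = (C 2ℚ *P X +P C 3ℚ) *P (y *P y) +P (C 1ℚ -P C 2ℚ *P X) *P (z *P z)

step-form : Poly → Poly → Poly
step-form p q = (C 2ℚ *P X +P C 1ℚ) *P p -P q

pell-form-in-chebyshev-variables : ∀ a b →
  pell-form (C ½ *P a +P C -½ *P b) (C ½ *P a +P C ½ *P b)
  ≋ a *P a +P b *P b -P (C 2ℚ *P X +P C 1ℚ) *P a *P b
pell-form-in-chebyshev-variables = solve 3 (λ x a b →
  (con 2ℚ :* x :+ con 3ℚ) :* ((con ½ :* a :+ con -½ :* b) :* (con ½ :* a :+ con -½ :* b))
  :+ (con 1ℚ :- con 2ℚ :* x) :* ((con ½ :* a :+ con ½ :* b) :* (con ½ :* a :+ con ½ :* b))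
  := a :* a :+ b :* b :- (con 2ℚ :* x :+ con 1ℚ) :* a :* b) ≋-refl X
  where open ℚ[x]-Solver

open Chebyshev xh

w≋2x+1 : w ≋ C 2ℚ *P X +P C 1ℚ
w≋2x+1 = mk λ { 0 → refl ; 1 → refl ; 2 → refl ; (suc (suc (suc i))) → refl }

Y-combination : ∀ n → Y n ≋ combination ½ -½ n
Y-combination n = ≋-trans (≋-sym (C-*P ½ (u (suc n) -P u n))) (halve (u (suc n)) (u n))
  where
  open ℚ[x]-Solver
  halve : ∀ a b → C ½ *P (a -P b) ≋ C ½ *P a +P C -½ *P b
  halve = solve 2 (λ a b → con ½ :* (a :- b) := con ½ :* a :+ con -½ :* b) ≋-refl

Z-combination : ∀ n → Z n ≋ combination ½ ½ n
Z-combination n = ≋-trans (≋-sym (C-*P ½ (u (suc n) +P u n))) (*P-distribˡ (C ½) (u (suc n)) (u n))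

step-form-cong : ∀ {p p′ q q′} → p ≋ p′ → q ≋ q′ → step-form p q ≋ step-form p′ q′
step-form-cong e f = +P-cong (*P-congʳ (C 2ℚ *P X +P C 1ℚ) e) (·P-cong f)

pell-form-cong : ∀ {y y′ z z′} → y ≋ y′ → z ≋ z′ → pell-form y z ≋ pell-form y′ z′
pell-form-cong e f =
  +P-cong (*P-congʳ (C 2ℚ *P X +P C 3ℚ) (*P-cong e e)) (*P-congʳ (C 1ℚ -P C 2ℚ *P X) (*P-cong f f))

combination-step : ∀ α β (s : ℕ → Poly) → (∀ n → s n ≋ combination α β n) →
                   ∀ n → s (suc (suc n)) ≋ step-form (s (suc n)) (s n)
combination-step α β s s≋ n = begin
  s (suc (suc n))                                            ≈⟨ s≋ (suc (suc n)) ⟩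
  combination α β (suc (suc n))                              ≈⟨ combination-recurrence α β n ⟩
  w *P combination α β (suc n) -P combination α β n          ≈⟨ +P-cong (*P-congˡ (combination α β (suc n)) w≋2x+1) ≋-refl ⟩
  step-form (combination α β (suc n)) (combination α β n)    ≈⟨ step-form-cong (s≋ (suc n)) (s≋ n) ⟨
  step-form (s (suc n)) (s n)                                ∎
  where open ≋-Reasoning

Y-Z-solve-pell : ∀ n → pell-form (Y n) (Z n) ≋ C 1ℚ
Y-Z-solve-pell n = begin
  pell-form (Y n) (Z n)                                             ≈⟨ pell-form-cong (Y-combination n) (Z-combination n) ⟩
  pell-form (combination ½ -½ n) (combination ½ ½ n)                ≈⟨ pell-form-in-chebyshev-variables a b ⟩
  a *P a +P b *P b -P (C 2ℚ *P X +P C 1ℚ) *P a *P b                 ≈⟨ +P-cong ≋-refl (·P-cong (*P-congˡ b (*P-congˡ a (≋-sym w≋2x+1)))) ⟩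
  a *P a +P b *P b -P w *P a *P b                                   ≈⟨ invariant n ⟩
  C 1ℚ                                                              ∎
  where
  open ≋-Reasoning
  a b : Poly
  a = u (suc n)
  b = u n

Y₀ : Y 0 ≈P X
Y₀ = λ { 0 → refl ; 1 → refl ; 2 → refl ; 3 → refl ; (suc (suc (suc (suc i)))) → refl }

Y₁ : Y 1 ≈P C 2ℚ *P X *P X +P X +P C -½
Y₁ = λ { 0 → refl ; 1 → refl ; 2 → refl ; 3 → refl ; 4 → refl ; (suc (suc (suc (suc (suc i))))) → refl }

Z₀ : Z 0 ≈P X +P C 1ℚ
Z₀ = λ { 0 → refl ; 1 → refl ; 2 → refl ; 3 → refl ; (suc (suc (suc (suc i)))) → refl }

Z₁ : Z 1 ≈P C 2ℚ *P X *P X +P C 3ℚ *P X +P C ½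
Z₁ = λ { 0 → refl ; 1 → refl ; 2 → refl ; 3 → refl ; 4 → refl ; (suc (suc (suc (suc (suc i))))) → refl }

eval : ℚ → Poly → ℚ
eval t []      = 0ℚ
eval t (a ∷ p) = a +q t *q eval t p

module Evaluation (t : ℚ) where
  open +-*-Solver

  eval-zero : ∀ q → [] ≋ q → 0ℚ ≡ eval t q
  eval-zero []      e = refl
  eval-zero (b ∷ q) e = begin
    0ℚ                      ≡⟨ zero-horner ⟨
    0ℚ +q t *q 0ℚ           ≡⟨ cong₂ (λ c r → c +q t *q r) (get e 0) (eval-zero q (mk λ i → get e (suc i))) ⟩
    b +q t *q eval t q      ∎
    where
    open ≡-Reasoning
    zero-horner : 0ℚ +q t *q 0ℚ ≡ 0ℚ
    zero-horner = solve 1 (λ t → con 0ℚ :+ t :* con 0ℚ := con 0ℚ) refl t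

  eval-cong : ∀ {p q} → p ≋ q → eval t p ≡ eval t q
  eval-cong {[]}    {q}     e = eval-zero q e
  eval-cong {a ∷ p} {[]}    e = sym (eval-zero (a ∷ p) (≋-sym e))
  eval-cong {a ∷ p} {b ∷ q} e = cong₂ (λ c r → c +q t *q r) (get e 0) (eval-cong (tail-≋ e))

  eval-+ : ∀ p q → eval t (p +P q) ≡ eval t p +q eval t q
  eval-+ []      q       = sym (ℚP.+-identityˡ (eval t q))
  eval-+ (a ∷ p) []      = sym (ℚP.+-identityʳ (eval t (a ∷ p)))
  eval-+ (a ∷ p) (b ∷ q) = trans (cong (λ r → (a +q b) +q t *q r) (eval-+ p q)) (horner (eval t p) (eval t q))
    where
    horner : ∀ x y → (a +q b) +q t *q (x +q y) ≡ (a +q t *q x) +q (b +q t *q y)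
    horner = solve 5 (λ a b t x y → (a :+ b) :+ t :* (x :+ y) := (a :+ t :* x) :+ (b :+ t :* y)) refl a b t

  eval-· : ∀ c p → eval t (c ·P p) ≡ c *q eval t p
  eval-· c []      = sym (ℚP.*-zeroʳ c)
  eval-· c (a ∷ p) = trans (cong (λ r → c *q a +q t *q r) (eval-· c p)) (horner (eval t p))
    where
    horner : ∀ x → c *q a +q t *q (c *q x) ≡ c *q (a +q t *q x)
    horner = solve 4 (λ c a t x → c :* a :+ t :* (c :* x) := c :* (a :+ t :* x)) refl c a t

  eval-* : ∀ p q → eval t (p *P q) ≡ eval t p *q eval t q
  eval-* []      q = sym (ℚP.*-zeroˡ (eval t q))
  eval-* (a ∷ p) q = begin
    eval t (a ·P q +P (0ℚ ∷ (p *P q)))                  ≡⟨ eval-+ (a ·P q) (0ℚ ∷ (p *P q)) ⟩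
    eval t (a ·P q) +q (0ℚ +q t *q eval t (p *P q))     ≡⟨ cong₂ (λ r s → r +q (0ℚ +q t *q s)) (eval-· a q) (eval-* p q) ⟩
    a *q eval t q +q (0ℚ +q t *q (eval t p *q eval t q)) ≡⟨ horner (eval t p) (eval t q) ⟩
    (a +q t *q eval t p) *q eval t q                    ∎
    where
    open ≡-Reasoning
    horner : ∀ x y → a *q y +q (0ℚ +q t *q (x *q y)) ≡ (a +q t *q x) *q y
    horner = solve 4 (λ a t x y → a :* y :+ (con 0ℚ :+ t :* (x :* y)) := (a :+ t :* x) :* y) refl a t

-- At x = ½ the recurrence operator becomes  (p, q) ↦ 2p − q, so the values
-- zₙ = Zₙ(½) form an arithmetic progression with difference Z₁(½) − Z₀(½) = 1.
open Evaluation ½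

z : ℕ → ℚ
z n = eval ½ (Z n)

eval-step-form : ∀ p q → eval ½ (step-form p q) ≡ 2ℚ *q eval ½ p +q (-q 1ℚ) *q eval ½ q
eval-step-form p q = trans (eval-+ ((C 2ℚ *P X +P C 1ℚ) *P p) ((-q 1ℚ) ·P q)) (cong₂ _+q_ (eval-* (C 2ℚ *P X +P C 1ℚ) p) (eval-· (-q 1ℚ) q))

z-successor : ∀ n → z (suc n) ≡ z n +q 1ℚ
z-successor zero    = refl
z-successor (suc n) = begin
  z (suc (suc n))                       ≡⟨ eval-cong (combination-step ½ ½ Z Z-combination n) ⟩
  eval ½ (step-form (Z (suc n)) (Z n))  ≡⟨ eval-step-form (Z (suc n)) (Z n) ⟩
  2ℚ *q z (suc n) +q (-q 1ℚ) *q z n     ≡⟨ cong (λ r → 2ℚ *q r +q (-q 1ℚ) *q z n) (z-successor n) ⟩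
  2ℚ *q (z n +q 1ℚ) +q (-q 1ℚ) *q z n   ≡⟨ arithmetic (z n) ⟩
  (z n +q 1ℚ) +q 1ℚ                     ≡⟨ cong (_+q 1ℚ) (z-successor n) ⟨
  z (suc n) +q 1ℚ                       ∎
  where
  open ≡-Reasoning
  open +-*-Solver
  arithmetic : ∀ x → 2ℚ *q (x +q 1ℚ) +q (-q 1ℚ) *q x ≡ (x +q 1ℚ) +q 1ℚ
  arithmetic = solve 1 (λ x → con 2ℚ :* (x :+ con 1ℚ) :+ con (-q 1ℚ) :* x := (x :+ con 1ℚ) :+ con 1ℚ) refl

z<z-successor : ∀ n → z n <q z (suc n)
z<z-successor n = subst₂ _<q_ (ℚP.+-identityʳ (z n)) (sym (z-successor n)) (ℚP.+-monoʳ-< (z n) (ℚP.positive⁻¹ 1ℚ))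

z-strictly-increasing : ∀ {m n} → m < n → z m <q z n
z-strictly-increasing {m} {suc n} (s≤s m≤n) with ℕP.m≤n⇒m<n∨m≡n m≤n
... | inj₁ m<n  = ℚP.<-trans (z-strictly-increasing m<n) (z<z-successor n)
... | inj₂ refl = z<z-successor n

Z-injective : ∀ m n → m ≢ n → ¬ (Z m ≈P Z n)
Z-injective m n m≢n e with ℕP.<-cmp m n
... | tri< m<n _ _ = ℚP.<-irrefl (eval-cong {Z m} {Z n} (mk e)) (z-strictly-increasing m<n)
... | tri≈ _ m≡n _ = m≢n m≡n
... | tri> _ _ n<m = ℚP.<-irrefl (sym (eval-cong {Z m} {Z n} (mk e))) (z-strictly-increasing n<m)

proposition3p1 :
    (∀ n → (C 2ℚ *P X +P C 3ℚ) *P (Y n *P Y n) +P (C 1ℚ -P C 2ℚ *P X) *P (Z n *P Z n) ≈P C 1ℚ)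
    × (∀ m n → m ≢ n → ¬ ((Y m ≈P Y n) × (Z m ≈P Z n)))
    × (∀ n → Y (suc (suc n)) ≈P (C 2ℚ *P X +P C 1ℚ) *P Y (suc n) -P Y n)
    × (∀ n → Z (suc (suc n)) ≈P (C 2ℚ *P X +P C 1ℚ) *P Z (suc n) -P Z n)
    × (Y 0 ≈P X)
    × (Y 1 ≈P C 2ℚ *P X *P X +P X +P C -½)
    × (Z 0 ≈P X +P C 1ℚ)
    × (Z 1 ≈P C 2ℚ *P X *P X +P C 3ℚ *P X +P C ½)
proposition3p1 =
    (λ n → get (Y-Z-solve-pell n))
  , (λ m n m≢n (_ , Zm≈Zn) → Z-injective m n m≢n Zm≈Zn)
  , (λ n → get (combination-step ½ -½ Y Y-combination n))
  , (λ n → get (combination-step ½ ½ Z Z-combination n))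
  , Y₀ , Y₁ , Z₀ , Z₁
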